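{- Let $\mathcal L$ be the fragment of $\mathbf{ACT}_\omega$ without the unit $\mathbf 1$ (but with $\bot$ and $\top$) and with positive iteration $^+$ instead of Kleene iteration. Then $\mathcal L$ is strongly complete with respect to SCL-models with the standard interpretation of $\bot$: for every set $\mathcal H$ of sequents and every sequent $\Pi\to C$ of $\mathcal L$, if $\Pi\to C$ is true in every such model in which all sequents of $\mathcal H$ are true, then $\mathcal H\vdash_{\mathcal L}\Pi\to C$.
   Context: Formulae of $\mathcal L$: built from countably many variables and constants $\top,\bot$ with $\backslash,/,\cdot,\wedge,\vee$ and unary $^+$. Sequents $A_1,\dots,A_n\to B$ with $n\ge0$ (empty antecedents allowed). Rules: $A\to A$; $\Gamma,\bot,\Delta\to C$; $\Pi\to\top$; from $\Gamma,A,B,\Delta\to C$ infer $\Gamma,A\cdot B,\Delta\to C$; from $\Gamma\to A$, $\Delta\to B$ infer $\Gamma,\Delta\to A\cdot B$; from $\Pi\to A$ and $\Gamma,B,\Delta\to C$ infer $\Gamma,\Pi,A\backslash B,\Delta\to C$ and $\Gamma,B/A,\Pi,\Delta\to C$; from $A,\Pi\to B$ infer $\Pi\to A\backslash B$; from $\Pi,A\to B$ infer $\Pi\to B/A$ ($\Pi$ may be empty); from $\Gamma,A,\Delta\to C$ (or $\Gamma,B,\Delta\to C$) infer $\Gamma,A\wedge B,\Delta\to C$; from $\Pi\to A$, $\Pi\to B$ infer $\Pi\to A\wedge B$; from $\Gamma,A,\Delta\to C$ and $\Gamma,B,\Delta\to C$ infer $\Gamma,A\vee B,\Delta\to C$;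 from $\Pi\to A$ (or $\Pi\to B$) infer $\Pi\to A\vee B$; Cut: from $\Pi\to A$ and $\Gamma,A,\Delta\to C$ infer $\Gamma,\Pi,\Delta\to C$; from $\Gamma,A^n,\Delta\to C$ for all $n\ge1$ infer $\Gamma,A^+,\Delta\to C$; for $n\ge1$ from $\Pi_1\to A,\dots,\Pi_n\to A$ infer $\Pi_1,\dots,\Pi_n\to A^+$. Derivations may be infinite but well-founded; $\mathcal H\vdash$ means derivability with $\mathcal H$ as extra axioms. SCL-models with standard $\bot$: alphabet $\Sigma$, $L\subseteq\Sigma^*$; $M^{\rhd}=\{(x,y)\in\Sigma^*\times\Sigma^*\mid\forall w\in M\;xwy\in L\}$, $C^{\lhd}=\{v\in\Sigma^*\mid\forall (x,y)\in C\;xvy\in L\}$; $\mathcal B(L)=\{M\subseteq\Sigma^*\mid M=M^{\rhd\lhd}\}$; an interpretation $\alpha$ of variables in $\mathcal B(L)$ extended by $\alpha(A\cdot B)=(\alpha(A)\alpha(B))^{\rhd\lhd}$, $\alpha(A\backslash B)=\{u\mid\forall v\in\alpha(A)\;vu\in\alpha(B)\}$, $\alpha(B/A)=\{u\mid\forall v\in\alpha(A)\;uv\in\alpha(B)\}$, $\alpha(A\wedge B)=\alpha(A)\cap\alpha(B)$, $\alpha(A\vee B)=(\alpha(A)\cup\alpha(B))^{\rhd\lhd}$, $\alpha(A^+)=(\bigcup_{n\ge1}\alpha(A)^n)^{\rhd\lhd}$, $\alpha(\top)=\Sigma^*$, $\alpha(\bot)=\varnothing^{\rhd\lhd}$. $A_1,\dots,A_n\to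 B$ ($n\ge1$) is true if $(\alpha(A_1)\cdots\alpha(A_n))^{\rhd\lhd}\subseteq\alpha(B)$; $\to B$ is true if $\varepsilon\in\alpha(B)$. -}

module Defs where

open import Data.Nat using (ℕ; zero; suc)
open import Data.List using (List; []; _∷_; _++_; [_]; replicate; concat)
open import Data.List.Relation.Unary.All using (All)
open import Data.Product using (Σ; ∃; _×_; _,_)
open import Data.Sum using (_⊎_)
open import Data.Unit using (⊤)
open import Data.Empty using (⊥)
open import Relation.Binary.PropositionalEquality using (_≡_)

infixr 30 _·_
infixr 25 _⧵_
infixl 25 _/_
infixr 20 _∧_
infixr 15 _∨_
infix 40 _⁺

data Formula : Set where
  var : ℕ → Formula
  ⊤ᶠ ⊥ᶠ : Formula
  _⧵_ _/_ _·_ _∧_ _∨_ : Formula → Formula → Formula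
  _⁺ : Formula → Formula

infix 2 _⇒_

record Sequent : Set where
  constructor _⇒_
  field
    ant : List Formula
    suc′ : Formula

-- Derivability in L with the sequents of H as extra axioms.
-- Derivations are (possibly infinitely branching) well-founded trees.

infix 3 _⊢_

data _⊢_ (H : Sequent → Set) : Sequent → Set where
  hyp  : ∀ {s} → H s → H ⊢ s
  ax   : ∀ {A} → H ⊢ ([ A ] ⇒ A)
  ⊥L   : ∀ {Γ Δ C} → H ⊢ (Γ ++ ⊥ᶠ ∷ Δ ⇒ C)
  ⊤R   : ∀ {Π} → H ⊢ (Π ⇒ ⊤ᶠ)
  ·L   : ∀ {Γ Δ A B C} → H ⊢ (Γ ++ A ∷ B ∷ Δ ⇒ C) → H ⊢ (Γ ++ A · B ∷ Δ ⇒ C)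
  ·R   : ∀ {Γ Δ A B} → H ⊢ (Γ ⇒ A) → H ⊢ (Δ ⇒ B) → H ⊢ (Γ ++ Δ ⇒ A · B)
  ⧵L   : ∀ {Γ Π Δ A B C} → H ⊢ (Π ⇒ A) → H ⊢ (Γ ++ B ∷ Δ ⇒ C) →
         H ⊢ (Γ ++ Π ++ A ⧵ B ∷ Δ ⇒ C)
  /L   : ∀ {Γ Π Δ A B C} → H ⊢ (Π ⇒ A) → H ⊢ (Γ ++ B ∷ Δ ⇒ C) →
         H ⊢ (Γ ++ B / A ∷ Π ++ Δ ⇒ C)
  ⧵R   : ∀ {Π A B} → H ⊢ (A ∷ Π ⇒ B) → H ⊢ (Π ⇒ A ⧵ B)
  /R   : ∀ {Π A B} → H ⊢ (Π ++ [ A ] ⇒ B) → H ⊢ (Π ⇒ B / A)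
  ∧L₁  : ∀ {Γ Δ A B C} → H ⊢ (Γ ++ A ∷ Δ ⇒ C) → H ⊢ (Γ ++ A ∧ B ∷ Δ ⇒ C)
  ∧L₂  : ∀ {Γ Δ A B C} → H ⊢ (Γ ++ B ∷ Δ ⇒ C) → H ⊢ (Γ ++ A ∧ B ∷ Δ ⇒ C)
  ∧R   : ∀ {Π A B} → H ⊢ (Π ⇒ A) → H ⊢ (Π ⇒ B) → H ⊢ (Π ⇒ A ∧ B)
  ∨L   : ∀ {Γ Δ A B C} → H ⊢ (Γ ++ A ∷ Δ ⇒ C) → H ⊢ (Γ ++ B ∷ Δ ⇒ C) →
         H ⊢ (Γ ++ A ∨ B ∷ Δ ⇒ C)
  ∨R₁  : ∀ {Π A B} → H ⊢ (Π ⇒ A) → H ⊢ (Π ⇒ A ∨ B)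
  ∨R₂  : ∀ {Π A B} → H ⊢ (Π ⇒ B) → H ⊢ (Π ⇒ A ∨ B)
  cut  : ∀ {Γ Π Δ A C} → H ⊢ (Π ⇒ A) → H ⊢ (Γ ++ A ∷ Δ ⇒ C) →
         H ⊢ (Γ ++ Π ++ Δ ⇒ C)
  -- ω-rule: premises Γ, Aⁿ, Δ → C for all n ≥ 1  (n = suc k)
  ⁺L   : ∀ {Γ Δ A C} → ((k : ℕ) → H ⊢ (Γ ++ replicate (suc k) A ++ Δ ⇒ C)) →
         H ⊢ (Γ ++ A ⁺ ∷ Δ ⇒ C)
  ⁺R   : ∀ {Π₁ Πs A} → All (λ Π → H ⊢ (Π ⇒ A)) (Π₁ ∷ Πs) →
         H ⊢ (concat (Π₁ ∷ Πs) ⇒ A ⁺)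

module SCL (Σ' : Set) (L : List Σ' → Set) where

  Lang : Set₁
  Lang = List Σ' → Set

  Ctx : Set₁
  Ctx = List Σ' → List Σ' → Set

  _⊆_ : Lang → Lang → Set
  M ⊆ N = ∀ w → M w → N w

  _▷ : Lang → Ctx
  (M ▷) x y = ∀ w → M w → L (x ++ w ++ y)

  _◁ : Ctx → Lang
  (C ◁) v = ∀ x y → C x y → L (x ++ v ++ y)

  cl : Lang → Lang
  cl M = (M ▷) ◁

  Closed : Lang → Set
  Closed M = (M ⊆ cl M) × (cl M ⊆ M)

  _•_ : Lang → Lang → Lang
  (M • N) w = ∃ λ u → ∃ λ v → (w ≡ u ++ v) × M u × N v

  -- pow M k = M^(k+1)
  pow : Lang → ℕ → Lang
  pow M zero = M
  pow M (suc k) = M • pow M k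

  record Interp : Set₁ where
    field
      val    : ℕ → Lang
      closed : ∀ p → Closed (val p)

  module _ (α : Interp) where
    open Interp α

    ⟦_⟧ : Formula → Lang
    ⟦ var p ⟧ = val p
    ⟦ ⊤ᶠ ⟧ = λ _ → ⊤
    ⟦ ⊥ᶠ ⟧ = cl (λ _ → ⊥)
    ⟦ A · B ⟧ = cl (⟦ A ⟧ • ⟦ B ⟧)
    ⟦ A ⧵ B ⟧ u = ∀ v → ⟦ A ⟧ v → ⟦ B ⟧ (v ++ u)
    ⟦ B / A ⟧ u = ∀ v → ⟦ A ⟧ v → ⟦ B ⟧ (u ++ v)
    ⟦ A ∧ B ⟧ w = ⟦ A ⟧ w × ⟦ B ⟧ w
    ⟦ A ∨ B ⟧ = cl (λ w → ⟦ A ⟧ w ⊎ ⟦ B ⟧ w)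
    ⟦ A ⁺ ⟧ = cl (λ w → ∃ λ k → pow ⟦ A ⟧ k w)

    prod : Formula → List Formula → Lang
    prod A [] = ⟦ A ⟧
    prod A (A′ ∷ As) = ⟦ A ⟧ • prod A′ As

    True : Sequent → Set
    True ([] ⇒ B) = ⟦ B ⟧ []
    True (A ∷ As ⇒ B) = cl (prod A As) ⊆ ⟦ B ⟧

StrongCompleteness : Set₁
StrongCompleteness =
  (H : Sequent → Set) (s : Sequent) →
  ((Σ' : Set) (L : List Σ' → Set) (α : SCL.Interp Σ' L) →
     (∀ h → H h → SCL.True Σ' L α h) → SCL.True Σ' L α s) →
  H ⊢ s

{-# OPTIONS --safe #-}
-- Besides a letter for every formula there is a goal letter for every formula
-- D; a word stands for the sequent whose antecedent reads its letters (goal letters as ⊤) and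
-- whose succedent is D if the word ends in the goal letter of D, and ⊥ otherwise. L consists of
-- the words whose sequent is derivable from H, and p denotes {w | H ⊢ w ⇒ p}. Truth lemma: every
-- A denotes {w | H ⊢ w ⇒ A}. This set is closed because the context (ε, goal A) accepts exactly
-- the words deriving A; and a word deriving A · B, A ∨ B, A⁺ or ⊥ lies in the closure of the set
-- defining its denotation, because a context accepting the premises of the corresponding left
-- rule accepts the word by that rule and cut. Succedent ⊥ for goal-free words is what makes ⊥
-- standard: the words accepted by every context are those deriving ⊥. Hence the hypotheses are
-- true, and a true sequent is derivable since its antecedent, spelled in formula letters, lies
-- in the product of the denotations.
module Submission where

open import Defs
open import Data.Nat using (zero; suc)
open import Data.List using (List; []; _∷_; _++_; [_]; _∷ʳ_; replicate; concat; map; initLast; _∷ʳ′_)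
open import Data.List.Properties using (++-assoc; ++-identityʳ; map-++; map-∘; map-id; map-replicate; concat-map)
open import Data.List.Relation.Unary.All as All using (All; []; _∷_)
open import Data.List.Relation.Unary.All.Properties using (map⁺)
open import Data.Product using (∃₂; _×_; _,_)
open import Data.Sum using (inj₁; inj₂)
open import Data.Unit using (tt)
open import Function using (_∘_)
open import Relation.Binary.PropositionalEquality using (_≡_; refl; sym; trans; cong; cong₂; subst)

module _ {H : Sequent → Set} where

  cast : ∀ {Γ Γ′ C} → Γ ≡ Γ′ → H ⊢ (Γ ⇒ C) → H ⊢ (Γ′ ⇒ C)
  cast refl d = d

  cut-end : ∀ {Γ A C} → H ⊢ (Γ ⇒ A) → H ⊢ ([ A ] ⇒ C) → H ⊢ (Γ ⇒ C)
  cut-end {Γ} d e = cast (++-identityʳ Γ) (cut {Γ = []} {Δ = []} d e)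

  ex-falso : ∀ {Γ C} → H ⊢ (Γ ⇒ ⊥ᶠ) → H ⊢ (Γ ⇒ C)
  ex-falso d = cut-end d (⊥L {Γ = []} {Δ = []})

  drop-⊤ʳ : ∀ Γ {C} → H ⊢ (Γ ∷ʳ ⊤ᶠ ⇒ C) → H ⊢ (Γ ⇒ C)
  drop-⊤ʳ Γ d = cast (++-identityʳ Γ) (cut {Γ = Γ} {Π = []} {Δ = []} ⊤R d)

  ⧵-apply : ∀ {Π Γ A B} → H ⊢ (Π ⇒ A) → H ⊢ (Γ ⇒ A ⧵ B) → H ⊢ (Π ++ Γ ⇒ B)
  ⧵-apply {Π} {Γ} a f =
    cast (cong (Π ++_) (++-identityʳ Γ)) (cut {Γ = Π} {Δ = []} f (⧵L {Γ = []} {Δ = []} a ax))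

  /-apply : ∀ {Γ Π A B} → H ⊢ (Γ ⇒ B / A) → H ⊢ (Π ⇒ A) → H ⊢ (Γ ++ Π ⇒ B)
  /-apply {Γ} {Π} f a =
    cast (cong (Γ ++_) (++-identityʳ Π)) (cut {Γ = []} {Δ = Π ++ []} f (/L {Γ = []} {Δ = []} a ax))

module Languages (Σ' : Set) (L : List Σ' → Set) where
  open SCL Σ' L

  cl-extensive : ∀ {M} → M ⊆ cl M
  cl-extensive w m x y f = f w m

  pow-replicate : ∀ {M c} → M [ c ] → ∀ k → pow M k (replicate (suc k) c)
  pow-replicate m zero = m
  pow-replicate m (suc k) = _ , _ , refl , m , pow-replicate m k

  pow-factors : ∀ {M} k w → pow M k w → ∃₂ λ u us → All M (u ∷ us) × concat (u ∷ us) ≡ w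
  pow-factors zero w m = w , [] , m ∷ [] , ++-identityʳ w
  pow-factors (suc k) _ (u , v , refl , m , p) with pow-factors k v p
  ... | u′ , us , ms , eq = u , u′ ∷ us , m ∷ ms , cong (u ++_) eq

data Letter : Set where
  fml goal : Formula → Letter

formula : Letter → Formula
formula (fml A) = A
formula (goal _) = ⊤ᶠ

read : List Letter → List Formula
read = map formula

read-fml : ∀ Π → read (map fml Π) ≡ Π
read-fml Π = trans (sym (map-∘ Π)) (map-id Π)

-- The clause for two or more letters precedes the one-letter clauses so that it computes
-- without inspecting the head letter, which antecedent-++ and succedent-++ rely on.
antecedent : List Letter → List Formula
antecedent [] = []
antecedent (c ∷ c′ ∷ w) = formula c ∷ antecedent (c′ ∷ w)
antecedent (fml A ∷ []) = [ A ]
antecedent (goal _ ∷ []) = []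

succedent : List Letter → Formula
succedent [] = ⊥ᶠ
succedent (_ ∷ c′ ∷ w) = succedent (c′ ∷ w)
succedent (fml _ ∷ []) = ⊥ᶠ
succedent (goal D ∷ []) = D

sequentOf : List Letter → Sequent
sequentOf w = antecedent w ⇒ succedent w

antecedent-++ : ∀ x {c y} → antecedent (x ++ c ∷ y) ≡ read x ++ antecedent (c ∷ y)
antecedent-++ [] = refl
antecedent-++ (_ ∷ []) = refl
antecedent-++ (c ∷ c′ ∷ x) = cong (formula c ∷_) (antecedent-++ (c′ ∷ x))

succedent-++ : ∀ x {c y} → succedent (x ++ c ∷ y) ≡ succedent (c ∷ y)
succedent-++ [] = refl
succedent-++ (_ ∷ []) = refl
succedent-++ (_ ∷ c′ ∷ x) = succedent-++ (c′ ∷ x)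

sequentOf-++ : ∀ x {c y} →
  sequentOf (x ++ c ∷ y) ≡ (read x ++ antecedent (c ∷ y) ⇒ succedent (c ∷ y))
sequentOf-++ x = cong₂ _⇒_ (antecedent-++ x) (succedent-++ x)

sequentOf-goal : ∀ v D → sequentOf (v ∷ʳ goal D) ≡ (read v ⇒ D)
sequentOf-goal v D = trans (sequentOf-++ v) (cong (_⇒ D) (++-identityʳ (read v)))

antecedent-fml : ∀ Π y → antecedent (map fml Π ++ y) ≡ Π ++ antecedent y
antecedent-fml [] y = refl
antecedent-fml (A ∷ Π) y = trans (head (map fml Π ++ y)) (cong (A ∷_) (antecedent-fml Π y))
  where
  head : ∀ v → antecedent (fml A ∷ v) ≡ A ∷ antecedent v
  head [] = refl
  head (_ ∷ _) = refl

succedent-fml : ∀ Π y → succedent (map fml Π ++ y) ≡ succedent y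
succedent-fml [] y = refl
succedent-fml (A ∷ Π) y = trans (head (map fml Π ++ y)) (succedent-fml Π y)
  where
  head : ∀ v → succedent (fml A ∷ v) ≡ succedent v
  head [] = refl
  head (_ ∷ _) = refl

module Canonical (H : Sequent → Set) where

  L : List Letter → Set
  L w = H ⊢ sequentOf w

  open SCL Letter L hiding (⟦_⟧)
  open Languages Letter L

  derives : Formula → Lang
  derives A w = H ⊢ (read w ⇒ A)

  L-⊥ : derives ⊥ᶠ ⊆ L
  L-⊥ w d with initLast w
  ... | [] = d
  ... | v ∷ʳ′ c =
    subst (H ⊢_) (sym (sequentOf-++ v)) (close c (cast (map-++ formula v [ c ]) d))
    where
    close : ∀ c → H ⊢ (read v ∷ʳ formula c ⇒ ⊥ᶠ) →
            H ⊢ (read v ++ antecedent [ c ] ⇒ succedent [ c ])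
    close (fml _) d = d
    close (goal _) d = cast (sym (++-identityʳ (read v))) (ex-falso (drop-⊤ʳ (read v) d))

  L-plug : ∀ x w y → H ⊢ (read x ++ read w ++ antecedent y ⇒ succedent y) → L (x ++ w ++ y)
  L-plug x w [] d = L-⊥ (x ++ w ++ []) (cast (sym distribute) d)
    where
    distribute : read (x ++ w ++ []) ≡ read x ++ read w ++ []
    distribute = trans (map-++ formula x (w ++ [])) (cong (read x ++_) (map-++ formula w []))
  L-plug x w (c ∷ y) d =
    subst L (++-assoc x w (c ∷ y)) (subst (H ⊢_) (sym (sequentOf-++ (x ++ w))) (cast regroup d))
    where
    regroup : read x ++ read w ++ antecedent (c ∷ y) ≡ read (x ++ w) ++ antecedent (c ∷ y)
    regroup = trans (sym (++-assoc (read x) (read w) _)) (cong (_++ _) (sym (map-++ formula x w)))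

  L-unplug : ∀ x A Π y → L (x ++ map fml (A ∷ Π) ++ y) →
             H ⊢ (read x ++ A ∷ Π ++ antecedent y ⇒ succedent y)
  L-unplug x A Π y = subst (H ⊢_) (trans (sequentOf-++ x)
    (cong₂ (λ Γ C → read x ++ Γ ⇒ C) (antecedent-fml (A ∷ Π) y) (succedent-fml (A ∷ Π) y)))

  L-cut : ∀ x w y {A} → derives A w →
          H ⊢ (read x ++ A ∷ antecedent y ⇒ succedent y) → L (x ++ w ++ y)
  L-cut x w y d e = L-plug x w y (cut {Γ = read x} {Δ = antecedent y} d e)

  cl-derives : ∀ C {M} → M ⊆ derives C → cl M ⊆ derives C
  cl-derives C M⊆C w w∈ = subst (H ⊢_) (sequentOf-goal w C)
    (w∈ [] [ goal C ] λ v m → subst (H ⊢_) (sym (sequentOf-goal v C)) (M⊆C v m))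

  pow⊆derives⁺ : ∀ {M A} → M ⊆ derives A → ∀ k → pow M k ⊆ derives (A ⁺)
  pow⊆derives⁺ {A = A} M⊆A k w p with pow-factors k w p
  ... | u , us , ms , refl =
    cast (concat-map (u ∷ us)) (⁺R (map⁺ {P = λ Π → H ⊢ (Π ⇒ A)} (All.map (M⊆A _) ms)))

  α : Interp
  α = record { val = derives ∘ var ; closed = λ p → cl-extensive , cl-derives (var p) λ _ d → d }

  ⟦_⟧ : Formula → Lang
  ⟦_⟧ = SCL.⟦_⟧ Letter L α

  ⟦⟧⊆derives : ∀ A → ⟦ A ⟧ ⊆ derives A
  derives⊆⟦⟧ : ∀ A → derives A ⊆ ⟦ A ⟧

  fml∈⟦_⟧ : ∀ A → ⟦ A ⟧ [ fml A ]
  fml∈⟦ A ⟧ = derives⊆⟦⟧ A [ fml A ] ax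

  ⟦⟧⊆derives (var p) w d = d
  ⟦⟧⊆derives ⊤ᶠ w _ = ⊤R
  ⟦⟧⊆derives ⊥ᶠ = cl-derives ⊥ᶠ λ _ ()
  ⟦⟧⊆derives (A · B) = cl-derives (A · B) λ { _ (u , v , refl , a , b) →
    cast (sym (map-++ formula u v)) (·R (⟦⟧⊆derives A u a) (⟦⟧⊆derives B v b)) }
  ⟦⟧⊆derives (A ⧵ B) w f = ⧵R (⟦⟧⊆derives B (fml A ∷ w) (f [ fml A ] fml∈⟦ A ⟧))
  ⟦⟧⊆derives (B / A) w f =
    /R (cast (map-++ formula w [ fml A ]) (⟦⟧⊆derives B (w ∷ʳ fml A) (f [ fml A ] fml∈⟦ A ⟧)))
  ⟦⟧⊆derives (A ∧ B) w (a , b) = ∧R (⟦⟧⊆derives A w a) (⟦⟧⊆derives B w b)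
  ⟦⟧⊆derives (A ∨ B) = cl-derives (A ∨ B) λ
    { w (inj₁ a) → cut-end (⟦⟧⊆derives A w a) (∨R₁ ax)
    ; w (inj₂ b) → cut-end (⟦⟧⊆derives B w b) (∨R₂ ax) }
  ⟦⟧⊆derives (A ⁺) = cl-derives (A ⁺) λ { w (k , p) → pow⊆derives⁺ (⟦⟧⊆derives A) k w p }

  derives⊆⟦⟧ (var p) w d = d
  derives⊆⟦⟧ ⊤ᶠ w _ = tt
  derives⊆⟦⟧ ⊥ᶠ w d x y _ = L-cut x w y d (⊥L {Γ = read x})
  derives⊆⟦⟧ (A · B) w d x y h = L-cut x w y d (·L {Γ = read x}
    (L-unplug x A [ B ] y (h (fml A ∷ fml B ∷ [])
      ([ fml A ] , [ fml B ] , refl , fml∈⟦ A ⟧ , fml∈⟦ B ⟧))))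
  derives⊆⟦⟧ (A ⧵ B) w d v a =
    derives⊆⟦⟧ B (v ++ w) (cast (sym (map-++ formula v w)) (⧵-apply (⟦⟧⊆derives A v a) d))
  derives⊆⟦⟧ (B / A) w d v a =
    derives⊆⟦⟧ B (w ++ v) (cast (sym (map-++ formula w v)) (/-apply d (⟦⟧⊆derives A v a)))
  derives⊆⟦⟧ (A ∧ B) w d = derives⊆⟦⟧ A w (cut-end d (∧L₁ {Γ = []} {Δ = []} ax))
                         , derives⊆⟦⟧ B w (cut-end d (∧L₂ {Γ = []} {Δ = []} ax))
  derives⊆⟦⟧ (A ∨ B) w d x y h = L-cut x w y d (∨L {Γ = read x}
    (L-unplug x A [] y (h [ fml A ] (inj₁ fml∈⟦ A ⟧)))
    (L-unplug x B [] y (h [ fml B ] (inj₂ fml∈⟦ B ⟧))))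
  derives⊆⟦⟧ (A ⁺) w d x y h = L-cut x w y d (⁺L {Γ = read x} λ k →
    L-unplug x A (replicate k A) y (h (map fml (replicate (suc k) A))
      (k , subst (pow ⟦ A ⟧ k) (sym (map-replicate fml (suc k) A)) (pow-replicate fml∈⟦ A ⟧ k))))

  prod⊆derives : ∀ {A As B} → H ⊢ (A ∷ As ⇒ B) → prod α A As ⊆ derives B
  prod⊆derives {A} {[]} d w a = cut-end (⟦⟧⊆derives A w a) d
  prod⊆derives {A} {_ ∷ _} d _ (u , v , refl , a , p) =
    cast (sym (map-++ formula u v)) (⧵-apply (⟦⟧⊆derives A u a) (prod⊆derives (⧵R d) v p))

  fml∈prod : ∀ A As → prod α A As (map fml (A ∷ As))
  fml∈prod A [] = fml∈⟦ A ⟧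
  fml∈prod A (A′ ∷ As) = [ fml A ] , _ , refl , fml∈⟦ A ⟧ , fml∈prod A′ As

  hypotheses-true : ∀ s → H s → True α s
  hypotheses-true ([] ⇒ B) h = derives⊆⟦⟧ B [] (hyp h)
  hypotheses-true (A ∷ As ⇒ B) h w = derives⊆⟦⟧ B w ∘ cl-derives B (prod⊆derives (hyp h)) w

  true⇒derivable : ∀ s → True α s → H ⊢ s
  true⇒derivable ([] ⇒ C) t = ⟦⟧⊆derives C [] t
  true⇒derivable (A ∷ As ⇒ C) t =
    cast (read-fml (A ∷ As)) (⟦⟧⊆derives C _ (t _ (cl-extensive _ (fml∈prod A As))))

theorem6 : StrongCompleteness
theorem6 H s valid = true⇒derivable s (valid Letter L α hypotheses-true)
  where open Canonical H
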